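{- Let $I$ be an object of $\mathcal{S}$ and $p_Y:Y\to I$ an object of $\mathcal{S}/I$. Then there is a map $\blacktriangleright_I Y\to\blacktriangleright Y$ making the square with sides $p_{\blacktriangleright_I Y}:\blacktriangleright_I Y\to I$, $\blacktriangleright p_Y:\blacktriangleright Y\to\blacktriangleright I$ and $\mathrm{next}_I:I\to\blacktriangleright I$ a pullback square.
   Context: $\mathcal{S}$ is the topos of presheaves on $\omega=\{1,2,\dots\}$ (sets $X(n)$, restrictions $r_n:X(n+1)\to X(n)$, $i|_n$ for iterated restriction). Later: $(\blacktriangleright X)(1)=\{\star\}$, $(\blacktriangleright X)(n+1)=X(n)$; $\mathrm{next}_X$ is the unique map at stage 1 and $r_n$ at stage $n+1$. $\mathcal{S}/I$ is equivalent to presheaves on the poset $\int I=\{(n,i)\mid i\in I(n)\}$ ordered by $(m,j)\le(n,i)$ iff $m\le n$ and $i|_m=j$, the object $p_Y$ corresponding to the presheaf $(n,i)\mapsto (p_Y)_n^{ -1}(i)$. For a presheaf $X$ on $\int I$, $\blacktriangleright_I X(1,i)=1$ and $\blacktriangleright_I X(n,i)=X(n-1,i|_{n-1})$ for $n>1$; $\blacktriangleright_I Y$ denotes the object of $\mathcal{S}/I$ corresponding to $\blacktriangleright_I$ applied to the presheaf of $p_Y$, with its projection $p_{\blacktriangleright_I Y}$ to $I$. -}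

module Defs where

open import Data.Nat using (ℕ; zero; suc)
open import Data.Unit using (⊤; tt)
open import Data.Product using (Σ; _,_; _×_; proj₁; proj₂)
open import Relation.Binary.PropositionalEquality using (_≡_; refl; cong; trans; sym)

-- Stage k : ℕ stands for the paper's stage k+1 (ω = {1,2,...}).
-- A presheaf on ω is a family of sets with restrictions r_n : X(n+1) → X(n);
-- functoriality is automatic since ω is freely generated by n ≤ n+1.
record PSh : Set₁ where
  field
    obj : ℕ → Set
    res : ∀ {n} → obj (suc n) → obj n
open PSh public

record Hom (X Y : PSh) : Set where
  field
    map : ∀ n → obj X n → obj Y n
    nat : ∀ n (x : obj X (suc n)) → map n (res X x) ≡ res Y (map (suc n) x)
open Hom public

_∘h_ : ∀ {X Y Z} → Hom Y Z → Hom X Y → Hom X Z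
map (g ∘h f) n x = map g n (map f n x)
nat (_∘h_ {X} {Y} {Z} g f) n x =
  trans (cong (map g n) (nat f n x)) (nat g n (map f (suc n) x))

_≈h_ : ∀ {X Y} → Hom X Y → Hom X Y → Set
f ≈h g = ∀ n x → map f n x ≡ map g n x

▶ : PSh → PSh
obj (▶ X) zero = ⊤
obj (▶ X) (suc n) = obj X n
res (▶ X) {zero} _ = tt
res (▶ X) {suc n} x = res X x

▶₁ : ∀ {X Y} → Hom X Y → Hom (▶ X) (▶ Y)
map (▶₁ f) zero _ = tt
map (▶₁ f) (suc n) x = map f n x
nat (▶₁ f) zero x = refl
nat (▶₁ f) (suc n) x = nat f n x

next : ∀ X → Hom X (▶ X)
map (next X) zero _ = tt
map (next X) (suc n) x = res X x
nat (next X) zero x = refl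
nat (next X) (suc n) x = refl

-- Presheaves on the poset ∫I (determined by restrictions along the
-- generating relations (n, r i) ≤ (n+1, i)).
record PShOn (I : PSh) : Set₁ where
  field
    fobj : ∀ n → obj I n → Set
    fres : ∀ {n} {i : obj I (suc n)} → fobj (suc n) i → fobj n (res I i)
open PShOn public

Fib : ∀ {I Y : PSh} → Hom Y I → PShOn I
fobj (Fib {I} {Y} p) n i = Σ (obj Y n) (λ y → map p n y ≡ i)
fres (Fib {I} {Y} p) (y , e) = res Y y , trans (nat p _ y) (cong (res I) e)

▶I : ∀ {I} → PShOn I → PShOn I
fobj (▶I X) zero i = ⊤
fobj (▶I {I} X) (suc n) i = fobj X n (res I i)
fres (▶I X) {zero} _ = tt
fres (▶I X) {suc n} x = fres X x

-- Back from presheaves on ∫I to objects of S/I: total space and projection.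
Tot : ∀ {I} → PShOn I → PSh
obj (Tot {I} X) n = Σ (obj I n) (fobj X n)
res (Tot {I} X) (i , x) = res I i , fres X x

proj : ∀ {I} (X : PShOn I) → Hom (Tot X) I
map (proj X) n (i , _) = i
nat (proj X) n _ = refl

-- Pullback square in S:
--        g
--   P ------> B
--   |         |
--  f|         |k
--   v         v
--   A ------> C
--        h
IsPullback : ∀ {P A B C} (f : Hom P A) (g : Hom P B) (h : Hom A C) (k : Hom B C) → Set₁
IsPullback {P} {A} {B} {C} f g h k =
  ((h ∘h f) ≈h (k ∘h g)) ×
  (∀ (Z : PSh) (a : Hom Z A) (b : Hom Z B) → (h ∘h a) ≈h (k ∘h b) →
     Σ (Hom Z P) (λ u → ((f ∘h u) ≈h a) × (((g ∘h u) ≈h b) ×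
        (∀ (v : Hom Z P) → (f ∘h v) ≈h a → (g ∘h v) ≈h b → v ≈h u))))

module Submission where

-- Concretely, a point of ▶_I Y at stage 0 is a point i of I,
-- and at stage n+1 it is a point i ∈ I(n+1) together with y ∈ Y(n) lying over
-- the restriction of i.  The proof has three parts:
--   * the square commutes, because the fibre condition of a point is exactly
--     the equation required by the square;
--   * the two legs are jointly injective at every stage, since equality proofs
--     in a set are unique (axiom K), so a point is determined by (i , y);
--   * a cone (a , b) over the cospan factors through ▶_I Y by pairing a with b,
--     the cone equation supplying the fibre condition.
-- Uniqueness of the factorisation is then an instance of joint injectivity.

open import Defs
open import Data.Product using (Σ; _,_)
open import Data.Nat using (zero; suc)
open import Data.Unit using (tt)
open import Relation.Binary.PropositionalEquality using (_≡_; refl; cong; sym; trans)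
open import Axiom.UniquenessOfIdentityProofs.WithK using (uip)

pair-with-proof-≡ : {A C : Set} {f g : A → C}
  {x x' : A} {e : f x ≡ g x} {e' : f x' ≡ g x'} →
  x ≡ x' → _≡_ {A = Σ A (λ a → f a ≡ g a)} (x , e) (x' , e')
pair-with-proof-≡ {e = e} {e'} refl = cong (_ ,_) (uip e e')

module _ (I Y : PSh) (pY : Hom Y I) where

  ▶IY : PSh
  ▶IY = Tot (▶I (Fib pY))

  p▶IY : Hom ▶IY I
  p▶IY = proj (▶I (Fib pY))

  leg : Hom ▶IY (▶ Y)
  map leg zero    _             = tt
  map leg (suc n) (_ , (y , _)) = y
  nat leg zero    _ = refl
  nat leg (suc n) _ = refl

  -- The square commutes: at stage n+1 this is the fibre condition p_Y(y) = r(i).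
  square-commutes : (next I ∘h p▶IY) ≈h (▶₁ pY ∘h leg)
  square-commutes zero    _             = refl
  square-commutes (suc n) (_ , (_ , e)) = sym e

  legs-jointly-injective : ∀ n (x x' : obj ▶IY n) →
    map p▶IY n x ≡ map p▶IY n x' → map leg n x ≡ map leg n x' → x ≡ x'
  legs-jointly-injective zero    (i , tt) (.i , tt) refl _ = refl
  legs-jointly-injective (suc n) (i , (_ , _)) (.i , (_ , _)) refl y≡y' =
    cong (i ,_) (pair-with-proof-≡ y≡y')

  module _ (Z : PSh) (a : Hom Z I) (b : Hom Z (▶ Y))
           (cone : (next I ∘h a) ≈h (▶₁ pY ∘h b)) where

    gap : Hom Z ▶IY
    map gap zero    z = map a zero z , tt
    map gap (suc n) z = map a (suc n) z , (map b (suc n) z , sym (cone (suc n) z))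
    -- Naturality is checked on the two legs: for p▶IY it is naturality of a,
    -- for leg it is trivial at stage 0 and naturality of b afterwards.
    nat gap zero    z = legs-jointly-injective 0 _ _ (nat a 0 z) refl
    nat gap (suc n) z =
      legs-jointly-injective (suc n) _ _ (nat a (suc n) z) (nat b (suc n) z)

    gap-proj : (p▶IY ∘h gap) ≈h a
    gap-proj zero    _ = refl
    gap-proj (suc n) _ = refl

    gap-leg : (leg ∘h gap) ≈h b
    gap-leg zero    _ = refl
    gap-leg (suc n) _ = refl

    gap-unique : (v : Hom Z ▶IY) → (p▶IY ∘h v) ≈h a → (leg ∘h v) ≈h b → v ≈h gap
    gap-unique v v-proj v-leg n z =
      legs-jointly-injective n _ _
        (trans (v-proj n z) (sym (gap-proj n z)))
        (trans (v-leg n z) (sym (gap-leg n z)))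

proposition4p3 : (I Y : PSh) (pY : Hom Y I) →
    Σ (Hom (Tot (▶I (Fib pY))) (▶ Y)) (λ g →
    IsPullback (proj (▶I (Fib pY))) g (next I) (▶₁ pY))
proposition4p3 I Y pY =
  leg I Y pY ,
  (square-commutes I Y pY ,
   λ Z a b cone →
     gap I Y pY Z a b cone ,
     (gap-proj I Y pY Z a b cone ,
      (gap-leg I Y pY Z a b cone , gap-unique I Y pY Z a b cone)))
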